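{- Let $\Gamma$ be a finite connected graph (multiple edges and loops allowed) endowed with a strongly connected orientation, with $\dim H_1(\Gamma,\mathbb{R})\ge2$. Then $\Gamma$ contains a (not necessarily spanning) subgraph of one of the following two types: (a) $\Gamma_1$: two directed circuits $\gamma_1,\gamma_2$ meeting only at a single vertex $v^*$; (b) $\Gamma_2$: three paths $p_1,p_2,p_3$ between two distinct vertices $v^*$ and $v^{**}$, pairwise disjoint except at the end vertices $v^*,v^{**}$, where $p_1$ is a directed path from $v^{**}$ to $v^*$, while $p_2$ and $p_3$ are paths from $v^*$ to $v^{**}$.
   Context: Each edge $e$ is oriented from $\operatorname{source}(e)$ to $\operatorname{target}(e)$; the orientation is strongly connected if for any two vertices there is a directed path from one to the other. A path is a walk (sequence of vertices joined by successive edges, each traversed in either direction) whose vertices are all distinct; it is directed if every edge is traversed from its source to its target. A circuit is a walk returning to its starting vertex whose vertices are otherwise distinct, and a directed circuit is one in which every edge is traversed from source to target (a loop is a directed circuit). $H_1(\Gamma,\mathbb{R})$ is the first real homology of $\Gamma$ (kernel of the boundary map $\sum c_je_j\mapsto\sum c_j(\operatorname{source}(e_j)-\operatorname{target}(e_j))$). -}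

module Defs where

open import Data.Nat using (ℕ; _≤_)
open import Data.Fin using (Fin; zero; suc; _≟_)
open import Data.Integer using (ℤ; 0ℤ; 1ℤ; _+_; _-_; _*_)
open import Data.List using (List; []; _∷_; length; drop)
open import Data.List.Relation.Unary.All using (All)
open import Data.List.Relation.Unary.Unique.Propositional using (Unique)
open import Data.List.Membership.Propositional using (_∈_)
open import Data.Product using (Σ; _×_)
open import Data.Sum using (_⊎_)
open import Data.Empty using (⊥)
open import Relation.Nullary using (¬_; yes; no)
open import Relation.Binary.PropositionalEquality using (_≡_)

record Graph : Set where
  field
    nV  : ℕ
    nE  : ℕ
    src : Fin nE → Fin nV
    tgt : Fin nE → Fin nV

data Dir : Set where
  fwd bwd : Dir

sumFin : ∀ {k} → (Fin k → ℤ) → ℤ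
sumFin {ℕ.zero}  f = 0ℤ
sumFin {ℕ.suc k} f = f zero + sumFin (λ i → f (suc i))

module _ (G : Graph) where
  open Graph G

  Vertex : Set
  Vertex = Fin nV

  Edge : Set
  Edge = Fin nE

  start : Dir → Edge → Vertex
  start fwd e = src e
  start bwd e = tgt e

  end : Dir → Edge → Vertex
  end fwd e = tgt e
  end bwd e = src e

  data Walk : Vertex → Vertex → Set where
    []   : ∀ {v} → Walk v v
    step : ∀ {w} (e : Edge) (d : Dir) → Walk (end d e) w → Walk (start d e) w

  verts : ∀ {u w} → Walk u w → List Vertex
  verts {u} []          = u ∷ []
  verts (step e d p)    = start d e ∷ verts p

  edgesOf : ∀ {u w} → Walk u w → List Edge
  edgesOf []           = []
  edgesOf (step e d p) = e ∷ edgesOf p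

  dirsOf : ∀ {u w} → Walk u w → List Dir
  dirsOf []           = []
  dirsOf (step e d p) = d ∷ dirsOf p

  IsDirected : ∀ {u w} → Walk u w → Set
  IsDirected p = All (_≡ fwd) (dirsOf p)

  IsPath : ∀ {u w} → Walk u w → Set
  IsPath p = Unique (verts p)

  IsCircuit : ∀ {v} → Walk v v → Set
  IsCircuit p = (1 ≤ length (edgesOf p)) × Unique (drop 1 (verts p))

  Connected : Set
  Connected = (u w : Vertex) → Walk u w

  StronglyConnected : Set
  StronglyConnected =
    (u w : Vertex) → Σ (Walk u w) (λ p → IsDirected p × IsPath p)

  Chain : Set
  Chain = Edge → ℤ

  δ : Vertex → Vertex → ℤ
  δ a b with a ≟ b
  ... | yes _ = 1ℤ
  ... | no  _ = 0ℤ

  boundaryAt : Chain → Vertex → ℤ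
  boundaryAt c v = sumFin (λ e → c e * (δ (src e) v - δ (tgt e) v))

  IsCycle : Chain → Set
  IsCycle c = ∀ v → boundaryAt c v ≡ 0ℤ

  -- dim H₁(Γ,ℝ) ≥ 2: there are two linearly independent cycles.
  -- (The boundary map has integer matrix, so the real kernel has a basis of
  -- integer vectors; linear independence of integer vectors over ℝ is
  -- equivalent to independence over ℤ.)
  DimH1AtLeast2 : Set
  DimH1AtLeast2 =
    Σ Chain λ c₁ → Σ Chain λ c₂ → IsCycle c₁ × IsCycle c₂ ×
      ((a b : ℤ) → (∀ e → a * c₁ e + b * c₂ e ≡ 0ℤ) → (a ≡ 0ℤ) × (b ≡ 0ℤ))

  EdgeDisjoint : ∀ {a b c d} → Walk a b → Walk c d → Set
  EdgeDisjoint p q = ∀ e → e ∈ edgesOf p → e ∈ edgesOf q → ⊥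

  HasTypeA : Set
  HasTypeA =
    Σ Vertex λ v* → Σ (Walk v* v*) λ γ₁ → Σ (Walk v* v*) λ γ₂ →
      IsDirected γ₁ × IsCircuit γ₁ × IsDirected γ₂ × IsCircuit γ₂ ×
      (∀ x → x ∈ verts γ₁ → x ∈ verts γ₂ → x ≡ v*) ×
      EdgeDisjoint γ₁ γ₂

  MeetOnlyAtEnds : ∀ {a b c d} → Vertex → Vertex → Walk a b → Walk c d → Set
  MeetOnlyAtEnds v* v** p q =
    (∀ x → x ∈ verts p → x ∈ verts q → (x ≡ v*) ⊎ (x ≡ v**)) × EdgeDisjoint p q

  HasTypeB : Set
  HasTypeB =
    Σ Vertex λ v* → Σ Vertex λ v** → ¬ (v* ≡ v**) ×
      Σ (Walk v** v*) λ p₁ → Σ (Walk v* v**) λ p₂ → Σ (Walk v* v**) λ p₃ →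
        IsPath p₁ × IsDirected p₁ × IsPath p₂ × IsPath p₃ ×
        MeetOnlyAtEnds v* v** p₁ p₂ × MeetOnlyAtEnds v* v** p₁ p₃ ×
        MeetOnlyAtEnds v* v** p₂ p₃

{-# OPTIONS --safe #-}
module Submission where

-- Close an edge e₀, by a directed path back from its head, into a directed circuit C.
-- If C used every edge, no two edges would share a tail or a head, so by flow
-- conservation every cycle would be constant on the edges and H₁ would be at most
-- one-dimensional. Otherwise strong connectivity yields an edge f ∉ C leaving C at a
-- vertex a. A directed path from the head of f back to C, cut at the first vertex c where
-- it meets C, gives an ear from a to c. If c = a, the ear and C are two directed circuits
-- through a (type (a)); if c ≠ a, the ear and the two arcs of C between a and c are three
-- paths between c and a (type (b)).

open import Defs
open import Data.Empty using (⊥; ⊥-elim)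
open import Data.Fin using (Fin; zero; suc; _≟_)
open import Data.Fin.Properties using (any?; suc-injective)
open import Data.Integer using (ℤ; 0ℤ; 1ℤ; -_; _+_; _-_; _*_)
open import Data.Integer.Properties
  using (i-j≡0⇒i≡j; neg-injective; *-zeroˡ; *-zeroʳ; *-identityʳ; +-identityˡ; +-identityʳ)
open import Data.Integer.Tactic.RingSolver using (solve-∀)
open import Data.List using (List; []; _∷_; _++_; _∷ʳ_; map; length; drop; reverse)
open import Data.List.Properties using (length-++-comm; unfold-reverse)
import Data.List.Membership.DecPropositional as DecMembership
open import Data.List.Membership.Propositional using (_∈_; _∉_)
open import Data.List.Membership.Propositional.Properties using (∈-++⁺ˡ; ∈-++⁺ʳ; ∈-++⁻; ∈-map⁺)
open import Data.List.Relation.Binary.Disjoint.Propositional using (Disjoint)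
open import Data.List.Relation.Binary.Subset.Propositional using (_⊆_)
open import Data.List.Relation.Unary.All as All using (All; []; _∷_)
import Data.List.Relation.Unary.All.Properties as All
open import Data.List.Relation.Unary.AllPairs using ([]; _∷_)
open import Data.List.Relation.Unary.Any using (here; there)
open import Data.List.Relation.Unary.Any.Properties using (reverse⁻)
open import Data.List.Relation.Unary.Unique.Propositional using (Unique)
open import Data.List.Relation.Unary.Unique.Propositional.Properties using (++⁺)
import Data.Nat as ℕ
open import Data.Nat using (_≤_; s≤s; z≤n)
open import Data.Product using (Σ; ∃; _×_; _,_; proj₁; proj₂)
open import Data.Sum using (_⊎_; inj₁; inj₂; [_,_])
open import Function using (_∘_; id)
open import Function.Definitions using (Injective)
open import Relation.Nullary using (¬_; Dec; yes; no; ¬?)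
open import Relation.Nullary.Decidable using (decidable-stable)
open import Relation.Binary.PropositionalEquality
  using (_≡_; _≢_; refl; sym; trans; cong; cong₂; subst; module ≡-Reasoning)

module _ {A : Set} where

  unique-++⁻ˡ : ∀ (xs : List A) {ys} → Unique (xs ++ ys) → Unique xs
  unique-++⁻ˡ []       _          = []
  unique-++⁻ˡ (x ∷ xs) (x∉ ∷ xs!) = All.++⁻ˡ xs x∉ ∷ unique-++⁻ˡ xs xs!

  unique-++⁻ʳ : ∀ (xs : List A) {ys} → Unique (xs ++ ys) → Unique ys
  unique-++⁻ʳ []       ys!       = ys!
  unique-++⁻ʳ (x ∷ xs) (_ ∷ xs!) = unique-++⁻ʳ xs xs!

  unique-++⇒disjoint : ∀ (xs : List A) {ys} → Unique (xs ++ ys) → Disjoint xs ys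
  unique-++⇒disjoint (x ∷ xs) (x∉ ∷ _) (here refl , x∈ys) = All.lookup x∉ (∈-++⁺ʳ xs x∈ys) refl
  unique-++⇒disjoint (x ∷ xs) (_ ∷ xs!) (there v∈xs , v∈ys) =
    unique-++⇒disjoint xs xs! (v∈xs , v∈ys)

  unique-++-comm : ∀ (xs : List A) {ys} → Unique (xs ++ ys) → Unique (ys ++ xs)
  unique-++-comm xs xs! = ++⁺ (unique-++⁻ʳ xs xs!) (unique-++⁻ˡ xs xs!)
    (λ (v∈ys , v∈xs) → unique-++⇒disjoint xs xs! (v∈xs , v∈ys))

  unique-reverse : ∀ {xs : List A} → Unique xs → Unique (reverse xs)
  unique-reverse {[]}     _         = []
  unique-reverse {x ∷ xs} (x∉ ∷ xs!) = subst Unique (sym (unfold-reverse x xs))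
    (++⁺ (unique-reverse xs!) ([] ∷ [])
      λ { (x∈ , here refl) → All.lookup x∉ (reverse⁻ x∈) refl })

  unique-map⇒injective : ∀ {B : Set} (f : A → B) {xs} → Unique (map f xs) →
    ∀ {x y} → x ∈ xs → y ∈ xs → f x ≡ f y → x ≡ y
  unique-map⇒injective f (_ ∷ _)    (here refl) (here refl) _   = refl
  unique-map⇒injective f (fx∉ ∷ _) (here refl) (there y∈)  fx≡fy =
    ⊥-elim (All.lookup fx∉ (∈-map⁺ f y∈) fx≡fy)
  unique-map⇒injective f (fy∉ ∷ _) (there x∈)  (here refl) fx≡fy =
    ⊥-elim (All.lookup fy∉ (∈-map⁺ f x∈) (sym fx≡fy))
  unique-map⇒injective f (_ ∷ fxs!) (there x∈) (there y∈)  fx≡fy =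
    unique-map⇒injective f fxs! x∈ y∈ fx≡fy

sumFin-cong : ∀ {k} {f g : Fin k → ℤ} → (∀ i → f i ≡ g i) → sumFin f ≡ sumFin g
sumFin-cong {ℕ.zero}  _   = refl
sumFin-cong {ℕ.suc k} f≡g = cong₂ _+_ (f≡g zero) (sumFin-cong (f≡g ∘ suc))

sumFin-zero : ∀ {k} (f : Fin k → ℤ) → (∀ i → f i ≡ 0ℤ) → sumFin f ≡ 0ℤ
sumFin-zero {ℕ.zero}  f _    = refl
sumFin-zero {ℕ.suc k} f f≡0 = cong₂ _+_ (f≡0 zero) (sumFin-zero (f ∘ suc) (f≡0 ∘ suc))

sumFin-single : ∀ {k} (f : Fin k → ℤ) i → (∀ j → j ≢ i → f j ≡ 0ℤ) → sumFin f ≡ f i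
sumFin-single f zero f≡0 =
  trans (cong (f zero +_) (sumFin-zero (f ∘ suc) (λ j → f≡0 (suc j) λ ())))
        (+-identityʳ (f zero))
sumFin-single f (suc i) f≡0 =
  trans (cong₂ _+_ (f≡0 zero λ ())
                   (sumFin-single (f ∘ suc) i (λ j j≢i → f≡0 (suc j) (j≢i ∘ suc-injective))))
        (+-identityˡ (f (suc i)))

sumFin-minus : ∀ {k} (f g : Fin k → ℤ) → sumFin (λ i → f i - g i) ≡ sumFin f - sumFin g
sumFin-minus {ℕ.zero}  f g = refl
sumFin-minus {ℕ.suc k} f g =
  trans (cong (f zero - g zero +_) (sumFin-minus (f ∘ suc) (g ∘ suc)))
        (interchange (f zero) (g zero) (sumFin (f ∘ suc)) (sumFin (g ∘ suc)))
  where
  interchange : ∀ a b s t → (a - b) + (s - t) ≡ (a + s) - (b + t)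
  interchange = solve-∀

module _ {G : Graph} where
  open Graph G

  tailVerts : ∀ {u w} → Walk G u w → List (Vertex G)
  tailVerts p = drop 1 (verts G p)

  verts≡∷tailVerts : ∀ {u w} (p : Walk G u w) → verts G p ≡ u ∷ tailVerts p
  verts≡∷tailVerts []           = refl
  verts≡∷tailVerts (step e d p) = refl

  start∈verts : ∀ {u w} (p : Walk G u w) → u ∈ verts G p
  start∈verts []           = here refl
  start∈verts (step e d p) = here refl

  end∈verts : ∀ {u w} (p : Walk G u w) → w ∈ verts G p
  end∈verts []           = here refl
  end∈verts (step e d p) = there (end∈verts p)

  tailVerts⊆verts : ∀ {u w} (p : Walk G u w) → tailVerts p ⊆ verts G p
  tailVerts⊆verts []           ()
  tailVerts⊆verts (step e d p) = there

  verts⇒start⊎tailVerts : ∀ {u w x} (p : Walk G u w) → x ∈ verts G p → x ≡ u ⊎ x ∈ tailVerts p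
  verts⇒start⊎tailVerts []           (here refl) = inj₁ refl
  verts⇒start⊎tailVerts (step e d p) (here refl) = inj₁ refl
  verts⇒start⊎tailVerts (step e d p) (there x∈)  = inj₂ x∈

  end∈tailVerts : ∀ {u w} (p : Walk G u w) → u ≢ w → w ∈ tailVerts p
  end∈tailVerts p u≢w with verts⇒start⊎tailVerts p (end∈verts p)
  ... | inj₁ w≡u  = ⊥-elim (u≢w (sym w≡u))
  ... | inj₂ w∈ = w∈

  closed-verts⊆tailVerts : ∀ {v} (p : Walk G v v) → 1 ≤ length (edgesOf G p) →
                           verts G p ⊆ tailVerts p
  closed-verts⊆tailVerts (step e d p) _ (here refl) = end∈verts p
  closed-verts⊆tailVerts (step e d p) _ (there x∈)  = x∈

  isPath : ∀ {u w} (p : Walk G u w) → u ∉ tailVerts p → Unique (tailVerts p) → IsPath G p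
  isPath p u∉ tail! = subst Unique (sym (verts≡∷tailVerts p))
    (All.tabulate (λ x∈ u≡x → u∉ (subst (_∈ tailVerts p) (sym u≡x) x∈)) ∷ tail!)

  infixr 5 _++ʷ_
  _++ʷ_ : ∀ {u v w} → Walk G u v → Walk G v w → Walk G u w
  []         ++ʷ q = q
  step e d p ++ʷ q = step e d (p ++ʷ q)

  verts-++ʷ : ∀ {u v w} (p : Walk G u v) (q : Walk G v w) →
              verts G (p ++ʷ q) ≡ verts G p ++ tailVerts q
  verts-++ʷ []           q = verts≡∷tailVerts q
  verts-++ʷ (step e d p) q = cong (start G d e ∷_) (verts-++ʷ p q)

  tailVerts-++ʷ : ∀ {u v w} (p : Walk G u v) (q : Walk G v w) →
                  tailVerts (p ++ʷ q) ≡ tailVerts p ++ tailVerts q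
  tailVerts-++ʷ []           q = refl
  tailVerts-++ʷ (step e d p) q = verts-++ʷ p q

  edgesOf-++ʷ : ∀ {u v w} (p : Walk G u v) (q : Walk G v w) →
                edgesOf G (p ++ʷ q) ≡ edgesOf G p ++ edgesOf G q
  edgesOf-++ʷ []           q = refl
  edgesOf-++ʷ (step e d p) q = cong (e ∷_) (edgesOf-++ʷ p q)

  dirsOf-++ʷ : ∀ {u v w} (p : Walk G u v) (q : Walk G v w) →
               dirsOf G (p ++ʷ q) ≡ dirsOf G p ++ dirsOf G q
  dirsOf-++ʷ []           q = refl
  dirsOf-++ʷ (step e d p) q = cong (d ∷_) (dirsOf-++ʷ p q)

  isDirected-++ʷ : ∀ {u v w} (p : Walk G u v) {q : Walk G v w} →
                   IsDirected G p → IsDirected G q → IsDirected G (p ++ʷ q)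
  isDirected-++ʷ p {q} dp dq = subst (All (_≡ fwd)) (sym (dirsOf-++ʷ p q)) (All.++⁺ dp dq)

  isDirected-++ʷ⁻ˡ : ∀ {u v w} (p : Walk G u v) {q : Walk G v w} →
                     IsDirected G (p ++ʷ q) → IsDirected G p
  isDirected-++ʷ⁻ˡ p {q} d = All.++⁻ˡ (dirsOf G p) (subst (All (_≡ fwd)) (dirsOf-++ʷ p q) d)

  isDirected-++ʷ⁻ʳ : ∀ {u v w} (p : Walk G u v) {q : Walk G v w} →
                     IsDirected G (p ++ʷ q) → IsDirected G q
  isDirected-++ʷ⁻ʳ p {q} d = All.++⁻ʳ (dirsOf G p) (subst (All (_≡ fwd)) (dirsOf-++ʷ p q) d)

  isPath-++ʷ⁻ˡ : ∀ {u v w} (p : Walk G u v) {q : Walk G v w} → IsPath G (p ++ʷ q) → IsPath G p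
  isPath-++ʷ⁻ˡ p {q} pq! = unique-++⁻ˡ (verts G p) (subst Unique (verts-++ʷ p q) pq!)

  splitAt : ∀ {u w x} (p : Walk G u w) → x ∈ verts G p →
            Σ (Walk G u x) λ q₁ → Σ (Walk G x w) λ q₂ → p ≡ q₁ ++ʷ q₂
  splitAt []           (here refl) = [] , [] , refl
  splitAt (step e d p) (here refl) = [] , step e d p , refl
  splitAt (step e d p) (there x∈) with splitAt p x∈
  ... | q₁ , q₂ , refl = step e d q₁ , q₂ , refl

  traverseBack : ∀ d e → Walk G (end G d e) (start G d e)
  traverseBack fwd e = step e bwd []
  traverseBack bwd e = step e fwd []

  reverseʷ : ∀ {u w} → Walk G u w → Walk G w u
  reverseʷ []           = []
  reverseʷ (step e d p) = reverseʷ p ++ʷ traverseBack d e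

  verts-reverseʷ : ∀ {u w} (p : Walk G u w) → verts G (reverseʷ p) ≡ reverse (verts G p)
  verts-reverseʷ []           = refl
  verts-reverseʷ (step e d p) = begin
    verts G (reverseʷ p ++ʷ traverseBack d e)
      ≡⟨ verts-++ʷ (reverseʷ p) (traverseBack d e) ⟩
    verts G (reverseʷ p) ++ tailVerts (traverseBack d e)
      ≡⟨ cong₂ _++_ (verts-reverseʷ p) (tailVerts-back d) ⟩
    reverse (verts G p) ∷ʳ start G d e
      ≡⟨ unfold-reverse (start G d e) (verts G p) ⟨
    reverse (start G d e ∷ verts G p) ∎
    where
    open ≡-Reasoning
    tailVerts-back : ∀ d → tailVerts (traverseBack d e) ≡ start G d e ∷ []
    tailVerts-back fwd = refl
    tailVerts-back bwd = refl

  edgesOf-reverseʷ : ∀ {u w} (p : Walk G u w) → edgesOf G (reverseʷ p) ≡ reverse (edgesOf G p)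
  edgesOf-reverseʷ []           = refl
  edgesOf-reverseʷ (step e d p) = begin
    edgesOf G (reverseʷ p ++ʷ traverseBack d e)
      ≡⟨ edgesOf-++ʷ (reverseʷ p) (traverseBack d e) ⟩
    edgesOf G (reverseʷ p) ++ edgesOf G (traverseBack d e)
      ≡⟨ cong₂ _++_ (edgesOf-reverseʷ p) (edgesOf-back d) ⟩
    reverse (edgesOf G p) ∷ʳ e
      ≡⟨ unfold-reverse e (edgesOf G p) ⟨
    reverse (e ∷ edgesOf G p) ∎
    where
    open ≡-Reasoning
    edgesOf-back : ∀ d → edgesOf G (traverseBack d e) ≡ e ∷ []
    edgesOf-back fwd = refl
    edgesOf-back bwd = refl

  isPath-reverseʷ : ∀ {u w} (p : Walk G u w) → IsPath G p → IsPath G (reverseʷ p)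
  isPath-reverseʷ p p! = subst Unique (sym (verts-reverseʷ p)) (unique-reverse p!)

  infix 4 _⊑_
  _⊑_ : ∀ {u w x y} → Walk G u w → Walk G x y → Set
  p ⊑ q = (verts G p ⊆ verts G q) × (edgesOf G p ⊆ edgesOf G q)

  ⊑-trans : ∀ {u₁ w₁ u₂ w₂ u₃ w₃} {p : Walk G u₁ w₁} {q : Walk G u₂ w₂} {r : Walk G u₃ w₃} →
            p ⊑ q → q ⊑ r → p ⊑ r
  ⊑-trans (pv , pe) (qv , qe) = qv ∘ pv , qe ∘ pe

  ⊑-++ʷˡ : ∀ {u v w} (p : Walk G u v) (q : Walk G v w) → p ⊑ p ++ʷ q
  ⊑-++ʷˡ p q =
    (λ x∈ → subst (_ ∈_) (sym (verts-++ʷ p q)) (∈-++⁺ˡ x∈)) ,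
    (λ e∈ → subst (_ ∈_) (sym (edgesOf-++ʷ p q)) (∈-++⁺ˡ e∈))

  ⊑-++ʷʳ : ∀ {u v w} (p : Walk G u v) (q : Walk G v w) → q ⊑ p ++ʷ q
  ⊑-++ʷʳ p q = verts⊆ , (λ e∈ → subst (_ ∈_) (sym (edgesOf-++ʷ p q)) (∈-++⁺ʳ (edgesOf G p) e∈))
    where
    verts⊆ : verts G q ⊆ verts G (p ++ʷ q)
    verts⊆ x∈ with verts⇒start⊎tailVerts q x∈
    ... | inj₁ refl = proj₁ (⊑-++ʷˡ p q) (end∈verts p)
    ... | inj₂ x∈tail = subst (_ ∈_) (sym (verts-++ʷ p q)) (∈-++⁺ʳ (verts G p) x∈tail)

  reverseʷ-⊑ : ∀ {u w} (p : Walk G u w) → reverseʷ p ⊑ p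
  reverseʷ-⊑ p =
    (λ x∈ → reverse⁻ (subst (_ ∈_) (verts-reverseʷ p) x∈)) ,
    (λ e∈ → reverse⁻ (subst (_ ∈_) (edgesOf-reverseʷ p) e∈))

  meetOnlyAtEnds-⊑ʳ : ∀ {v* v** a b c d e f} {p : Walk G a b} {q : Walk G c d} {r : Walk G e f} →
    MeetOnlyAtEnds G v* v** p r → q ⊑ r → MeetOnlyAtEnds G v* v** p q
  meetOnlyAtEnds-⊑ʳ (meetV , meetE) (qv , qe) =
    (λ x x∈p x∈q → meetV x x∈p (qv x∈q)) , (λ e e∈p e∈q → meetE e e∈p (qe e∈q))

  src∈verts : ∀ {u w e} (p : Walk G u w) → IsDirected G p → e ∈ edgesOf G p → src e ∈ verts G p
  src∈verts (step e .fwd p) (refl ∷ _)  (here refl) = here refl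
  src∈verts (step e .fwd p) (refl ∷ dp) (there e∈) = there (src∈verts p dp e∈)

  tgt∈tailVerts : ∀ {u w e} (p : Walk G u w) → IsDirected G p →
                  e ∈ edgesOf G p → tgt e ∈ tailVerts p
  tgt∈tailVerts (step e .fwd p) (refl ∷ _)  (here refl) = start∈verts p
  tgt∈tailVerts (step e .fwd p) (refl ∷ dp) (there e∈) = tailVerts⊆verts p (tgt∈tailVerts p dp e∈)

  tailVerts≡map-tgt : ∀ {u w} (p : Walk G u w) → IsDirected G p →
                      tailVerts p ≡ map tgt (edgesOf G p)
  tailVerts≡map-tgt []              _           = refl
  tailVerts≡map-tgt (step e .fwd p) (refl ∷ dp) =
    trans (verts≡∷tailVerts p) (cong (tgt e ∷_) (tailVerts≡map-tgt p dp))

  verts≡map-src∷ʳ : ∀ {u w} (p : Walk G u w) → IsDirected G p →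
                    verts G p ≡ map src (edgesOf G p) ∷ʳ w
  verts≡map-src∷ʳ []              _           = refl
  verts≡map-src∷ʳ (step e .fwd p) (refl ∷ dp) = cong (src e ∷_) (verts≡map-src∷ʳ p dp)

  record DirectedCircuit (v : Vertex G) : Set where
    constructor directedCircuit
    field
      walk      : Walk G v v
      directed  : IsDirected G walk
      isCircuit : IsCircuit G walk

  open DirectedCircuit using (walk)

  directedCircuitThrough : StronglyConnected G → ∀ e → DirectedCircuit (src e)
  directedCircuitThrough SC e with SC (tgt e) (src e)
  ... | p , dp , p! = directedCircuit (step e fwd p) (refl ∷ dp) (s≤s z≤n , p!)

  rotate : ∀ {v x} (C : DirectedCircuit v) → x ∈ tailVerts (walk C) →
           Σ (DirectedCircuit x) λ C' → edgesOf G (walk C') ⊆ edgesOf G (walk C)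
  rotate (directedCircuit C dC (nonempty , C!)) x∈ with splitAt C (tailVerts⊆verts C x∈)
  ... | q₁ , q₂ , refl =
    directedCircuit (q₂ ++ʷ q₁)
      (isDirected-++ʷ q₂ (isDirected-++ʷ⁻ʳ q₁ dC) (isDirected-++ʷ⁻ˡ q₁ dC))
      (subst (1 ≤_) sameLength nonempty ,
       subst Unique (sym (tailVerts-++ʷ q₂ q₁))
         (unique-++-comm (tailVerts q₁) (subst Unique (tailVerts-++ʷ q₁ q₂) C!))) ,
    λ e∈ → [ proj₂ (⊑-++ʷʳ q₁ q₂) , proj₂ (⊑-++ʷˡ q₁ q₂) ]
             (∈-++⁻ (edgesOf G q₂) (subst (_ ∈_) (edgesOf-++ʷ q₂ q₁) e∈))
    where
    open ≡-Reasoning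
    sameLength : length (edgesOf G (q₁ ++ʷ q₂)) ≡ length (edgesOf G (q₂ ++ʷ q₁))
    sameLength = begin
      length (edgesOf G (q₁ ++ʷ q₂))          ≡⟨ cong length (edgesOf-++ʷ q₁ q₂) ⟩
      length (edgesOf G q₁ ++ edgesOf G q₂)   ≡⟨ length-++-comm (edgesOf G q₁) (edgesOf G q₂) ⟩
      length (edgesOf G q₂ ++ edgesOf G q₁)   ≡⟨ cong length (edgesOf-++ʷ q₂ q₁) ⟨
      length (edgesOf G (q₂ ++ʷ q₁))          ∎

  circuit-arcs : ∀ {a c} (C : DirectedCircuit a) → c ∈ tailVerts (walk C) → a ≢ c →
    Σ (Walk G c a) λ p₂ → Σ (Walk G c a) λ p₃ →
      IsPath G p₂ × IsPath G p₃ × MeetOnlyAtEnds G c a p₂ p₃ × p₂ ⊑ walk C × p₃ ⊑ walk C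
  circuit-arcs {a} {c} (directedCircuit C dC (_ , C!)) c∈ a≢c
    with splitAt C (tailVerts⊆verts C c∈)
  ... | q₁ , q₂ , refl =
    q₂ , reverseʷ q₁ ,
    isPath q₂ c∉tail₂ (unique-++⁻ʳ (tailVerts q₁) tails!) ,
    isPath-reverseʷ q₁ (isPath q₁ a∉tail₁ (unique-++⁻ˡ (tailVerts q₁) tails!)) ,
    (meetVerts , meetEdges) ,
    ⊑-++ʷʳ q₁ q₂ , ⊑-trans (reverseʷ-⊑ q₁) (⊑-++ʷˡ q₁ q₂)
    where
    tails! : Unique (tailVerts q₁ ++ tailVerts q₂)
    tails! = subst Unique (tailVerts-++ʷ q₁ q₂) C!
    tails-disjoint : ∀ {x} → x ∈ tailVerts q₁ → x ∈ tailVerts q₂ → ⊥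
    tails-disjoint x∈₁ x∈₂ = unique-++⇒disjoint (tailVerts q₁) tails! (x∈₁ , x∈₂)
    a∉tail₁ : a ∉ tailVerts q₁
    a∉tail₁ a∈ = tails-disjoint a∈ (end∈tailVerts q₂ (a≢c ∘ sym))
    c∉tail₂ : c ∉ tailVerts q₂
    c∉tail₂ = tails-disjoint (end∈tailVerts q₁ a≢c)
    meetVerts : ∀ x → x ∈ verts G q₂ → x ∈ verts G (reverseʷ q₁) → x ≡ c ⊎ x ≡ a
    meetVerts x x∈₂ x∈₁ with verts⇒start⊎tailVerts q₂ x∈₂
                           | verts⇒start⊎tailVerts q₁ (proj₁ (reverseʷ-⊑ q₁) x∈₁)
    ... | inj₁ x≡c   | _          = inj₁ x≡c
    ... | inj₂ _     | inj₁ x≡a   = inj₂ x≡a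
    ... | inj₂ x∈t₂ | inj₂ x∈t₁ = ⊥-elim (tails-disjoint x∈t₁ x∈t₂)
    meetEdges : EdgeDisjoint G q₂ (reverseʷ q₁)
    meetEdges e e∈₂ e∈₁ = tails-disjoint
      (tgt∈tailVerts q₁ (isDirected-++ʷ⁻ˡ q₁ dC) (proj₂ (reverseʷ-⊑ q₁) e∈₁))
      (tgt∈tailVerts q₂ (isDirected-++ʷ⁻ʳ q₁ dC) e∈₂)

module _ {G : Graph} (P : Vertex G → Set) (P? : ∀ x → Dec (P x)) where
  open Graph G

  exitEdge : ∀ {u w} (p : Walk G u w) → IsDirected G p → P u → ¬ P w →
             ∃ λ f → P (src f) × ¬ P (tgt f)
  exitEdge []              _           Pu ¬Pw = ⊥-elim (¬Pw Pu)
  exitEdge (step e .fwd p) (refl ∷ dp) Pu ¬Pw with P? (tgt e)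
  ... | yes Pt = exitEdge p dp Pt ¬Pw
  ... | no ¬Pt = e , Pu , ¬Pt

  data AvoidsBeforeEnd : ∀ {u w} → Walk G u w → Set where
    []  : ∀ {v} → AvoidsBeforeEnd ([] {v = v})
    _∷_ : ∀ {w e d} {p : Walk G (end G d e) w} →
          ¬ P (start G d e) → AvoidsBeforeEnd p → AvoidsBeforeEnd (step e d p)

  avoids-verts : ∀ {u w x} {p : Walk G u w} → AvoidsBeforeEnd p → x ∈ verts G p → x ≡ w ⊎ ¬ P x
  avoids-verts []        (here refl) = inj₁ refl
  avoids-verts (¬P ∷ _)  (here refl) = inj₂ ¬P
  avoids-verts (_ ∷ avs) (there x∈)  = avoids-verts avs x∈

  avoids-src : ∀ {u w e} {p : Walk G u w} → AvoidsBeforeEnd p → IsDirected G p →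
               e ∈ edgesOf G p → ¬ P (src e)
  avoids-src (¬P ∷ _)   (refl ∷ _)  (here refl) = ¬P
  avoids-src (_ ∷ avs) (refl ∷ dp) (there e∈) = avoids-src avs dp e∈

  firstHit : ∀ {u w} (p : Walk G u w) → P w →
    ∃ λ c → Σ (Walk G u c) λ q → Σ (Walk G c w) λ r →
      p ≡ q ++ʷ r × P c × AvoidsBeforeEnd q
  firstHit []           Pw = _ , [] , [] , refl , Pw , []
  firstHit (step e d p) Pw with P? (start G d e)
  ... | yes Ps = _ , [] , step e d p , refl , Ps , []
  ... | no ¬Ps with firstHit p Pw
  ...   | c , q , r , refl , Pc , avs = c , step e d q , r , refl , Pc , ¬Ps ∷ avs

module _ {G : Graph} where
  open Graph G
  open DirectedCircuit using (walk)
  open DecMembership (_≟_ {n = nV}) using (_∈?_)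

  record Ear {a} (C : Walk G a a) (c : Vertex G) : Set where
    field
      arc          : Walk G a c
      directed     : IsDirected G arc
      nonempty     : 1 ≤ length (edgesOf G arc)
      tailUnique   : Unique (tailVerts arc)
      end∈C        : c ∈ tailVerts C
      avoidsC      : ∀ {x} → x ∈ tailVerts arc → x ∈ verts G C → x ≡ c
      edgeDisjoint : EdgeDisjoint G arc C

  ear : StronglyConnected G → ∀ {f} (C : DirectedCircuit (src f)) → f ∉ edgesOf G (walk C) →
        ∃ (Ear (walk C))
  ear SC {f} (directedCircuit C dC (nonempty , _)) f∉C with SC (tgt f) (src f)
  ... | q , dq , q! with firstHit (_∈ tailVerts C) (_∈? tailVerts C) q
                           (closed-verts⊆tailVerts C nonempty (start∈verts C))
  ... | c , pre , _ , refl , c∈C , avs = c , record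
    { arc          = step f fwd pre
    ; directed     = refl ∷ dpre
    ; nonempty     = s≤s z≤n
    ; tailUnique   = isPath-++ʷ⁻ˡ pre q!
    ; end∈C        = c∈C
    ; avoidsC      = λ x∈pre x∈C → [ id , (λ x∉C → ⊥-elim (x∉C (verts⊆tailVerts x∈C))) ]
                                     (avoids-verts _ _ avs x∈pre)
    ; edgeDisjoint = λ { e (here refl) e∈C → f∉C e∈C
                       ; e (there e∈pre) e∈C →
                           avoids-src _ _ avs dpre e∈pre (verts⊆tailVerts (src∈verts C dC e∈C)) }
    }
    where
    verts⊆tailVerts : verts G C ⊆ tailVerts C
    verts⊆tailVerts = closed-verts⊆tailVerts C nonempty
    dpre : IsDirected G pre
    dpre = isDirected-++ʷ⁻ˡ pre dq

  ear⇒typeA : ∀ {a} (C : DirectedCircuit a) → Ear (walk C) a → HasTypeA G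
  ear⇒typeA {a} (directedCircuit C dC circuitC) E =
    a , C , arc , dC , circuitC , directed , (nonempty , tailUnique) ,
    (λ x x∈C x∈arc → [ id , (λ x∈tail → avoidsC x∈tail x∈C) ]
                       (verts⇒start⊎tailVerts arc x∈arc)) ,
    (λ e e∈C e∈arc → edgeDisjoint e e∈arc e∈C)
    where open Ear E

  ear⇒typeB : ∀ {a c} (C : DirectedCircuit a) → Ear (walk C) c → a ≢ c → HasTypeB G
  ear⇒typeB {a} {c} C E a≢c with circuit-arcs C (Ear.end∈C E) a≢c
  ... | p₂ , p₃ , p₂! , p₃! , meet₂₃ , p₂⊑C , p₃⊑C =
    c , a , a≢c ∘ sym , arc , p₂ , p₃ , arc! , directed , p₂! , p₃! ,
    meetOnlyAtEnds-⊑ʳ meetC p₂⊑C , meetOnlyAtEnds-⊑ʳ meetC p₃⊑C , meet₂₃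
    where
    open Ear E
    arc! : IsPath G arc
    arc! = isPath arc (λ a∈ → a≢c (avoidsC a∈ (start∈verts (walk C)))) tailUnique
    meetC : MeetOnlyAtEnds G c a arc (walk C)
    meetC = (λ x x∈arc x∈C → [ inj₂ , (λ x∈tail → inj₁ (avoidsC x∈tail x∈C)) ]
                               (verts⇒start⊎tailVerts arc x∈arc)) ,
            edgeDisjoint

  edge-leaving-circuit : StronglyConnected G → ∀ {v e} (C : DirectedCircuit v) →
    e ∉ edgesOf G (walk C) → ∃ λ f → src f ∈ tailVerts (walk C) × f ∉ edgesOf G (walk C)
  edge-leaving-circuit SC {v} {e} (directedCircuit C dC (nonempty , _)) e∉C
    with src e ∈? tailVerts C
  ... | yes src∈C = e , src∈C , e∉C
  ... | no src∉C with SC v (src e)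
  ...   | q , dq , _ with exitEdge (_∈ tailVerts C) (_∈? tailVerts C) q dq
                               (closed-verts⊆tailVerts C nonempty (start∈verts C)) src∉C
  ...     | f , src∈C , tgt∉C = f , src∈C , tgt∉C ∘ tgt∈tailVerts C dC

  edgeOffCircuit⇒typeA⊎typeB : StronglyConnected G → ∀ {v e} (C : DirectedCircuit v) →
    e ∉ edgesOf G (walk C) → HasTypeA G ⊎ HasTypeB G
  edgeOffCircuit⇒typeA⊎typeB SC C e∉C with edge-leaving-circuit SC C e∉C
  ... | f , src∈C , f∉C with rotate C src∈C
  ... | C' , C'⊆C with ear SC C' (f∉C ∘ C'⊆C)
  ... | c , E with src f ≟ c
  ... | yes refl = inj₁ (ear⇒typeA C' E)
  ... | no a≢c   = inj₂ (ear⇒typeB C' E a≢c)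

module _ {G : Graph} where
  open Graph G
  open DirectedCircuit using (walk)

  open DecMembership (_≟_ {n = nE}) using (_∈?_)

  LinearlyIndependent : Chain G → Chain G → Set
  LinearlyIndependent c₁ c₂ =
    (a b : ℤ) → (∀ e → a * c₁ e + b * c₂ e ≡ 0ℤ) → (a ≡ 0ℤ) × (b ≡ 0ℤ)

  constant-chains-dependent : ∀ {c₁ c₂ : Chain G} k₁ k₂ →
    (∀ e → c₁ e ≡ k₁) → (∀ e → c₂ e ≡ k₂) → ¬ LinearlyIndependent c₁ c₂
  constant-chains-dependent {c₁} {c₂} k₁ k₂ c₁≡k₁ c₂≡k₂ independent =
    1≢0 (proj₁ (independent 1ℤ 0ℤ c₁-vanishes))
    where
    1≢0 : 1ℤ ≢ 0ℤ
    1≢0 ()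
    cross-cancel : ∀ k₁ k₂ → k₂ * k₁ + - k₁ * k₂ ≡ 0ℤ
    cross-cancel = solve-∀
    k₁≡0 : k₁ ≡ 0ℤ
    k₁≡0 = neg-injective (proj₂ (independent k₂ (- k₁) λ e →
      trans (cong₂ (λ s t → k₂ * s + - k₁ * t) (c₁≡k₁ e) (c₂≡k₂ e)) (cross-cancel k₁ k₂)))
    c₁-vanishes : ∀ e → 1ℤ * c₁ e + 0ℤ * c₂ e ≡ 0ℤ
    c₁-vanishes e = cong₂ (λ s t → 1ℤ * s + t) (trans (c₁≡k₁ e) k₁≡0) (*-zeroˡ (c₂ e))

  δ-≡ : ∀ {a b : Vertex G} → a ≡ b → δ G a b ≡ 1ℤ
  δ-≡ {a} {b} a≡b with a ≟ b
  ... | yes _   = refl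
  ... | no a≢b = ⊥-elim (a≢b a≡b)

  δ-≢ : ∀ {a b : Vertex G} → a ≢ b → δ G a b ≡ 0ℤ
  δ-≢ {a} {b} a≢b with a ≟ b
  ... | yes a≡b = ⊥-elim (a≢b a≡b)
  ... | no _    = refl

  sumFin-*δ : (c : Chain G) (f : Edge G → Vertex G) {e : Edge G} {v : Vertex G} →
              f e ≡ v → (∀ x → f x ≡ v → x ≡ e) → sumFin (λ x → c x * δ G (f x) v) ≡ c e
  sumFin-*δ c f {e} {v} fe≡v only-e = begin
    sumFin (λ x → c x * δ G (f x) v)  ≡⟨ sumFin-single _ e other-terms-vanish ⟩
    c e * δ G (f e) v                 ≡⟨ cong (c e *_) (δ-≡ fe≡v) ⟩
    c e * 1ℤ                          ≡⟨ *-identityʳ (c e) ⟩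
    c e                               ∎
    where
    open ≡-Reasoning
    other-terms-vanish : ∀ x → x ≢ e → c x * δ G (f x) v ≡ 0ℤ
    other-terms-vanish x x≢e = trans (cong (c x *_) (δ-≢ (x≢e ∘ only-e x))) (*-zeroʳ (c x))

  boundaryAt-degreeOne : (c : Chain G) {v : Vertex G} {eₒ eᵢ : Edge G} →
    src eₒ ≡ v → (∀ x → src x ≡ v → x ≡ eₒ) →
    tgt eᵢ ≡ v → (∀ x → tgt x ≡ v → x ≡ eᵢ) →
    boundaryAt G c v ≡ c eₒ - c eᵢ
  boundaryAt-degreeOne c {v} src≡v only-eₒ tgt≡v only-eᵢ = begin
    boundaryAt G c v
      ≡⟨ sumFin-cong (λ x → *-distribˡ-minus (c x) (δ G (src x) v) (δ G (tgt x) v)) ⟩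
    sumFin (λ x → c x * δ G (src x) v - c x * δ G (tgt x) v)
      ≡⟨ sumFin-minus (λ x → c x * δ G (src x) v) (λ x → c x * δ G (tgt x) v) ⟩
    sumFin (λ x → c x * δ G (src x) v) - sumFin (λ x → c x * δ G (tgt x) v)
      ≡⟨ cong₂ _-_ (sumFin-*δ c src src≡v only-eₒ) (sumFin-*δ c tgt tgt≡v only-eᵢ) ⟩
    _ ∎
    where
    open ≡-Reasoning
    *-distribˡ-minus : ∀ a b c → a * (b - c) ≡ a * b - a * c
    *-distribˡ-minus = solve-∀

  cycle-conserved : ∀ {c} → IsCycle G c → Injective _≡_ _≡_ src → Injective _≡_ _≡_ tgt →
                    ∀ {e e'} → src e' ≡ tgt e → c e' ≡ c e
  cycle-conserved {c} cycle src-inj tgt-inj {e} {e'} src≡tgt =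
    i-j≡0⇒i≡j (c e') (c e) (trans
      (sym (boundaryAt-degreeOne c src≡tgt (λ x src≡ → src-inj (trans src≡ (sym src≡tgt)))
                                   refl (λ x tgt≡ → tgt-inj tgt≡)))
      (cycle (tgt e)))

  cycle-constant-along : ∀ {c} → IsCycle G c → Injective _≡_ _≡_ src → Injective _≡_ _≡_ tgt →
    ∀ {e u w} (p : Walk G u w) → IsDirected G p → tgt e ≡ u →
    ∀ {e'} → e' ∈ edgesOf G p → c e' ≡ c e
  cycle-constant-along cycle src-inj tgt-inj (step e' .fwd p) (refl ∷ _) tgt≡ (here refl) =
    cycle-conserved cycle src-inj tgt-inj (sym tgt≡)
  cycle-constant-along cycle src-inj tgt-inj (step e' .fwd p) (refl ∷ dp) tgt≡ (there e∈) =
    trans (cycle-constant-along cycle src-inj tgt-inj p dp refl e∈)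
          (cycle-conserved cycle src-inj tgt-inj (sym tgt≡))

  spanningCircuit⇒¬DimH1AtLeast2 : ∀ {v} (C : DirectedCircuit v) →
    (∀ e → e ∈ edgesOf G (walk C)) → ¬ DimH1AtLeast2 G
  spanningCircuit⇒¬DimH1AtLeast2 (directedCircuit [] _ (() , _))
  spanningCircuit⇒¬DimH1AtLeast2 (directedCircuit (step e₀ .fwd p) (refl ∷ dp) (_ , p!)) spans
                                 (c₁ , c₂ , cycle₁ , cycle₂ , independent) =
    constant-chains-dependent (c₁ e₀) (c₂ e₀) (constant cycle₁) (constant cycle₂) independent
    where
    C = step e₀ fwd p
    src-inj : Injective _≡_ _≡_ src
    src-inj = unique-map⇒injective src
      (unique-++-comm (map src (edgesOf G p)) (subst Unique (verts≡map-src∷ʳ p dp) p!))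
      (spans _) (spans _)
    tgt-inj : Injective _≡_ _≡_ tgt
    tgt-inj = unique-map⇒injective tgt (subst Unique (tailVerts≡map-tgt C (refl ∷ dp)) p!)
      (spans _) (spans _)
    constant : ∀ {c} → IsCycle G c → ∀ e → c e ≡ c e₀
    constant cycle e with spans e
    ... | here refl = refl
    ... | there e∈p = cycle-constant-along cycle src-inj tgt-inj p dp refl e∈p

  edgeless⇒¬DimH1AtLeast2 : ¬ Edge G → ¬ DimH1AtLeast2 G
  edgeless⇒¬DimH1AtLeast2 edgeless (_ , _ , _ , _ , independent) =
    constant-chains-dependent 0ℤ 0ℤ (⊥-elim ∘ edgeless) (⊥-elim ∘ edgeless) independent

  spans⊎edgeOff : ∀ {v} (C : DirectedCircuit v) →
                  (∀ e → e ∈ edgesOf G (walk C)) ⊎ ∃ λ e → e ∉ edgesOf G (walk C)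
  spans⊎edgeOff C with any? (λ e → ¬? (e ∈? edgesOf G (walk C)))
  ... | yes edgeOff  = inj₂ edgeOff
  ... | no noEdgeOff =
    inj₁ λ e → decidable-stable (e ∈? edgesOf G (walk C)) (λ e∉C → noEdgeOff (e , e∉C))

fin-inhabited? : ∀ n → Dec (Fin n)
fin-inhabited? ℕ.zero    = no λ ()
fin-inhabited? (ℕ.suc n) = yes zero

lemma3p2 : (G : Graph) → Connected G → StronglyConnected G → DimH1AtLeast2 G →
    HasTypeA G ⊎ HasTypeB G
lemma3p2 G _ SC dim₂ with fin-inhabited? (Graph.nE G)
... | no edgeless = ⊥-elim (edgeless⇒¬DimH1AtLeast2 {G = G} edgeless dim₂)
... | yes e₀ with directedCircuitThrough SC e₀
... | C with spans⊎edgeOff C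
... | inj₁ spans      = ⊥-elim (spanningCircuit⇒¬DimH1AtLeast2 C spans dim₂)
... | inj₂ (_ , e∉C) = edgeOffCircuit⇒typeA⊎typeB SC C e∉C
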